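{- Let $(L_n)_{n\ge0}$ be the Lucas sequence and $(F_n)_{n\ge0}$ the Fibonacci sequence. Let $\mathcal X_0$ be the set of positive integers of the form $L_0+\sum_{i\in I}L_i$ where $I$ is a finite (possibly empty) subset of $\{3,4,5,\ldots\}$ containing no two consecutive integers (such a representation of an element of $\mathcal X_0$ is unique), and let $q_0(1)<q_0(2)<\cdots$ be the elements of $\mathcal X_0$ in increasing order. For $j\ge 3$, the indices $i$ for which the largest summand in the representation of $q_0(i)$ is $L_j$ are exactly $i=F_{j-1}+1,\ldots,F_j$.
   Context: $L_0=2$, $L_1=1$, $L_n=L_{n-1}+L_{n-2}$ ($n\ge2$); $F_0=0$, $F_1=1$, $F_n=F_{n-1}+F_{n-2}$ ($n\ge 2$). Equivalently, $\mathcal X_0$ is the set of positive integers whose unique representation as a sum of Lucas numbers with pairwise non-consecutive indices, not using both $L_0$ and $L_2$, has $L_0$ as smallest summand. -}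

module Defs where

open import Data.Nat using (ℕ; zero; suc; _+_; _≤_)
open import Data.List using (List; []; _∷_; length; map)
open import Data.Nat.ListAction using (sum)
open import Data.List.Membership.Propositional using (_∈_)
open import Data.List.Relation.Unary.Unique.Propositional using (Unique)
open import Data.Product using (Σ; _×_; ∃)
open import Data.Unit using (⊤)
open import Relation.Binary.PropositionalEquality using (_≡_)

L : ℕ → ℕ
L zero = 2
L (suc zero) = 1
L (suc (suc n)) = L (suc n) + L n

F : ℕ → ℕ
F zero = 0
F (suc zero) = 1
F (suc (suc n)) = F (suc n) + F n

-- A finite set I ⊆ {3,4,5,...} with no two consecutive integers, listed
-- in strictly decreasing order (so the list is the canonical encoding of I).
ValidIdx : List ℕ → Set
ValidIdx [] = ⊤
ValidIdx (a ∷ []) = 3 ≤ a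
ValidIdx (a ∷ b ∷ l) = (2 + b ≤ a) × ValidIdx (b ∷ l)

value : List ℕ → ℕ
value I = L 0 + sum (map L I)

-- Index of the largest summand of the representation L_0 + Σ_{i∈I} L_i
-- (the largest element of I, or 0 when I is empty, i.e. the summand L_0).
largestIndex : List ℕ → ℕ
largestIndex [] = 0
largestIndex (a ∷ _) = a

X₀ : ℕ → Set
X₀ x = Σ (List ℕ) λ I → ValidIdx I × value I ≡ x

LargestSummandIs : ℕ → ℕ → Set
LargestSummandIs j x =
  Σ (List ℕ) λ I → ValidIdx I × value I ≡ x × largestIndex I ≡ j

-- x = q₀(i): x ∈ 𝒳₀ and exactly i elements of 𝒳₀ are ≤ x
-- (witnessed by a duplicate-free list of length i enumerating them).
IsNth : ℕ → ℕ → Set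
IsNth i x = X₀ x × Σ (List ℕ) λ l →
  Unique l × length l ≡ i × (∀ y → (y ∈ l → X₀ y × y ≤ x) × (X₀ y × y ≤ x → y ∈ l))

{-# OPTIONS --safe --termination-depth=2 #-}
-- The representations all of whose indices lie below n + 2 are listed in increasing
-- order of value by reps n, where reps (n + 2) = reps (n + 1) ++ map (n + 3 ∷_) (reps n):
-- a sum of non-consecutive Lucas numbers with largest index h is below L (h + 1), so every
-- representation using L (n + 3) exceeds every one that does not. Hence reps n has F (n + 1)
-- entries, and the representations with largest index j = m + 3 fill exactly the positions
-- F (j - 1) + 1, ..., F j of reps (m + 2). As the values of reps (m + 2) are increasing and
-- exhaust 𝒳₀ below L 0 + L (m + 4), these positions are the ranks in 𝒳₀.
module Submission where

open import Defs
open import Data.Empty using (⊥-elim)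
open import Data.List using (List; []; _∷_; [_]; _++_; length; map; filter)
open import Data.List.Properties using (length-++; length-map; map-++; ++-assoc; filter-++; filter-all; filter-none; filter-accept)
open import Data.List.Membership.Propositional using (_∈_)
open import Data.List.Membership.Propositional.Properties using (∈-++⁺ˡ; ∈-++⁺ʳ; ∈-++⁻; ∈-map⁺; ∈-map⁻; ∈-filter⁺; ∈-filter⁻; ∈-∃++)
open import Data.List.Membership.Propositional.Properties.WithK using (unique∧set⇒bag)
open import Data.List.Relation.Binary.BagAndSetEquality using (∼bag⇒↭)
open import Data.List.Relation.Binary.Permutation.Propositional.Properties using (↭-length)
open import Data.List.Relation.Unary.All as All using (All; []; _∷_)
open import Data.List.Relation.Unary.Any using (here)
open import Data.List.Relation.Unary.AllPairs as AllPairs using (AllPairs; []; _∷_)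
import Data.List.Relation.Unary.AllPairs.Properties as AllPairsₚ
open import Data.List.Relation.Unary.Unique.Propositional using (Unique)
import Data.List.Relation.Unary.Unique.Propositional.Properties as Uniqueₚ
open import Data.Nat using (ℕ; zero; suc; _+_; _∸_; _≤_; _<_; z≤n; s≤s; _≤?_)
open import Data.Nat.ListAction using (sum)
open import Data.Nat.Properties
open import Data.Product using (Σ; ∃; _×_; _,_; proj₁; proj₂; map₂)
open import Data.Sum using (inj₁; inj₂)
open import Data.Unit using (tt)
open import Relation.Nullary using (yes; no)
open import Function using (_on_)
open import Function.Bundles using (_⇔_; mk⇔; module Equivalence)
open import Relation.Binary.PropositionalEquality using (_≡_; refl; sym; trans; cong; cong₂; subst; module ≡-Reasoning)
open ≡-Reasoning

length-unique-set : ∀ {A : Set} {xs ys : List A} → Unique xs → Unique ys →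
                    (∀ z → z ∈ xs ⇔ z ∈ ys) → length xs ≡ length ys
length-unique-set ux uy eq = ↭-length (∼bag⇒↭ (unique∧set⇒bag ux uy (λ {z} → eq z)))

split-at : ∀ {A : Set} (xs : List A) {q} → q < length xs →
           ∃ λ P → ∃ λ x → ∃ λ S → xs ≡ P ++ x ∷ S × length P ≡ q
split-at (x ∷ xs) {zero}  _        = [] , x , xs , refl , refl
split-at (x ∷ xs) {suc q} (s≤s q<) with split-at xs q<
... | P , y , S , refl , refl = x ∷ P , y , S , refl , refl

length-prefix< : ∀ {A : Set} {xs P S : List A} {x} → xs ≡ P ++ x ∷ S → length P < length xs
length-prefix< {P = P} refl =
  subst (length P <_) (sym (length-++ P)) (m<m+n (length P) (s≤s z≤n))

sorted-split : ∀ P {x S} → AllPairs _<_ (P ++ x ∷ S) → All (_< x) P × All (x <_) S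
sorted-split []      (x<S ∷ _)    = [] , x<S
sorted-split (p ∷ P) (p<rest ∷ sorted) with sorted-split P sorted
... | P<x , x<S = All.lookup p<rest (∈-++⁺ʳ P (here refl)) ∷ P<x , x<S

length-filter-≤-split : ∀ P {x S} → AllPairs _<_ (P ++ x ∷ S) →
                        length (filter (_≤? x) (P ++ x ∷ S)) ≡ suc (length P)
length-filter-≤-split P {x} {S} sorted = begin
  length (filter (_≤? x) (P ++ x ∷ S))
    ≡⟨ cong length (filter-++ (_≤? x) P (x ∷ S)) ⟩
  length (filter (_≤? x) P ++ filter (_≤? x) (x ∷ S))
    ≡⟨ cong₂ (λ l k → length (l ++ k)) (filter-all (_≤? x) (All.map <⇒≤ P<x))
                                       (filter-accept (_≤? x) ≤-refl) ⟩
  length (P ++ x ∷ filter (_≤? x) S)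
    ≡⟨ cong (λ l → length (P ++ x ∷ l)) (filter-none (_≤? x) (All.map <⇒≱ x<S)) ⟩
  length (P ++ [ x ])
    ≡⟨ length-++ P ⟩
  length P + 1
    ≡⟨ +-comm (length P) 1 ⟩
  suc (length P) ∎
  where
  P<x = proj₁ (sorted-split P sorted)
  x<S = proj₂ (sorted-split P sorted)

module _ {V : List ℕ} {b : ℕ} (V-sorted : AllPairs _<_ V)
         (V-enum : ∀ y → y ∈ V ⇔ (X₀ y × y < b)) where

  isNth⇔length-filter-≤ : ∀ {x} → x ∈ V → ∀ i → IsNth i x ⇔ (i ≡ length (filter (_≤? x) V))
  isNth⇔length-filter-≤ {x} x∈V i = mk⇔ to from
    where
    T = filter (_≤? x) V

    T-members : ∀ y → y ∈ T ⇔ (X₀ y × y ≤ x)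
    T-members y = mk⇔
      (λ y∈T → let y∈V , y≤x = ∈-filter⁻ (_≤? x) {xs = V} y∈T
               in proj₁ (Equivalence.to (V-enum y) y∈V) , y≤x)
      (λ (Xy , y≤x) → ∈-filter⁺ (_≤? x) (Equivalence.from (V-enum y) (Xy , ≤-<-trans y≤x x<b)) y≤x)
      where x<b = proj₂ (Equivalence.to (V-enum x) x∈V)

    T-unique : Unique T
    T-unique = Uniqueₚ.filter⁺ (_≤? x) (AllPairs.map <⇒≢ V-sorted)

    to : IsNth i x → i ≡ length T
    to (_ , l , l-unique , refl , l-members) = length-unique-set l-unique T-unique λ y → mk⇔
      (λ y∈l → Equivalence.from (T-members y) (proj₁ (l-members y) y∈l))
      (λ y∈T → proj₂ (l-members y) (Equivalence.to (T-members y) y∈T))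

    from : i ≡ length T → IsNth i x
    from refl = proj₁ (Equivalence.to (V-enum x) x∈V) , T , T-unique , refl ,
                λ y → Equivalence.to (T-members y) , Equivalence.from (T-members y)

  isNth⇔prefix-length : ∀ {P x S} → V ≡ P ++ x ∷ S → ∀ i → IsNth i x ⇔ (i ≡ suc (length P))
  isNth⇔prefix-length {P} {x} {S} refl i = mk⇔
    (λ nth → trans (Equivalence.to (isNth⇔length-filter-≤ x∈V i) nth) rank)
    (λ i≡ → Equivalence.from (isNth⇔length-filter-≤ x∈V i) (trans i≡ (sym rank)))
    where
    x∈V = ∈-++⁺ʳ P (here refl)
    rank = length-filter-≤-split P V-sorted

L-pos : ∀ n → 0 < L n
L-pos zero          = s≤s z≤n
L-pos (suc zero)    = s≤s z≤n
L-pos (suc (suc n)) = <-≤-trans (L-pos (suc n)) (m≤m+n _ _)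

L-mono : ∀ {m n} → m ≤ n → L (suc m) ≤ L (suc n)
L-mono {n = zero} z≤n = ≤-refl
L-mono {m} {suc n} m≤1+n with m≤n⇒m<n∨m≡n m≤1+n
... | inj₁ (s≤s m≤n) = ≤-trans (L-mono m≤n) (m≤m+n _ _)
... | inj₂ refl      = ≤-refl

sum-L<L-suc-largestIndex : ∀ I → ValidIdx I → sum (map L I) < L (suc (largestIndex I))
sum-L<L-suc-largestIndex []                        _ = s≤s z≤n
sum-L<L-suc-largestIndex (suc (suc (suc k)) ∷ []) _ = +-monoʳ-< (L (3 + k)) (L-pos (2 + k))
sum-L<L-suc-largestIndex (1 ∷ [])                  (s≤s ())
sum-L<L-suc-largestIndex (2 ∷ [])                  (s≤s (s≤s ()))
sum-L<L-suc-largestIndex (suc (suc c) ∷ b ∷ I) (s≤s (s≤s b≤c) , valid) =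
  +-monoʳ-< (L (2 + c)) (<-≤-trans (sum-L<L-suc-largestIndex (b ∷ I) valid) (L-mono b≤c))

largestIndex<⇒value< : ∀ I {n} → ValidIdx I → largestIndex I < n → value I < L 0 + L n
largestIndex<⇒value< I valid (s≤s max≤n) =
  +-monoʳ-< (L 0) (<-≤-trans (sum-L<L-suc-largestIndex I valid) (L-mono max≤n))

value<⇒largestIndex< : ∀ I {n} → value I < L 0 + L (suc n) → largestIndex I < suc n
value<⇒largestIndex< []      _ = s≤s z≤n
value<⇒largestIndex< (a ∷ I) {n} v< with a ≤? n
... | yes a≤n = s≤s a≤n
... | no  a≰n with ≰⇒> a≰n
... | s≤s n≤a′ = ⊥-elim (<⇒≱ v< (+-monoʳ-≤ (L 0) (≤-trans (L-mono n≤a′) (m≤m+n _ _))))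

value-∷-mono : ∀ a {I J} → value I < value J → value (a ∷ I) < value (a ∷ J)
value-∷-mono a lt = +-monoʳ-< (L 0) (+-monoʳ-< (L a) (+-cancelˡ-< (L 0) _ _ lt))

ValidIdx-∷⁻ : ∀ a I → ValidIdx (a ∷ I) → 3 ≤ a × ValidIdx I × 2 + largestIndex I ≤ a
ValidIdx-∷⁻ a []      3≤a = 3≤a , tt , ≤-trans (n≤1+n 2) 3≤a
ValidIdx-∷⁻ a (b ∷ I) (2+b≤a , valid) =
  ≤-trans (proj₁ (ValidIdx-∷⁻ b I valid)) (≤-trans (m≤n+m b 2) 2+b≤a) , valid , 2+b≤a

ValidIdx-∷⁺ : ∀ a I → 3 ≤ a → ValidIdx I → 2 + largestIndex I ≤ a → ValidIdx (a ∷ I)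
ValidIdx-∷⁺ a []      3≤a _     _  = 3≤a
ValidIdx-∷⁺ a (b ∷ I) _   valid le = le , valid

reps : ℕ → List (List ℕ)
reps 0             = [ [] ]
reps 1             = [ [] ]
reps (suc (suc n)) = reps (suc n) ++ map ((3 + n) ∷_) (reps n)

mutual
  reps-sound : ∀ n {I} → I ∈ reps n → ValidIdx I × largestIndex I < 2 + n
  reps-sound 0 (here refl) = tt , s≤s z≤n
  reps-sound 1 (here refl) = tt , s≤s z≤n
  reps-sound (suc (suc n)) I∈ with ∈-++⁻ (reps (suc n)) I∈
  ... | inj₁ I∈old = map₂ m<n⇒m<1+n (reps-sound (suc n) I∈old)
  ... | inj₂ I∈new with ∈-map⁻ ((3 + n) ∷_) I∈new
  ... | r , r∈ , refl = ∷-reps-valid n r∈ , ≤-refl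

  ∷-reps-valid : ∀ m {r} → r ∈ reps m → ValidIdx ((3 + m) ∷ r)
  ∷-reps-valid m {r} r∈ with reps-sound m r∈
  ... | r-valid , r<2+m = ValidIdx-∷⁺ (3 + m) r (m≤m+n 3 m) r-valid (s≤s r<2+m)

mutual
  reps-complete : ∀ n I → ValidIdx I → largestIndex I < 2 + n → I ∈ reps n
  reps-complete 0 []      _     _   = here refl
  reps-complete 1 []      _     _   = here refl
  reps-complete 0 (a ∷ I) valid a<2 = ⊥-elim (<⇒≱ a<2 (≤-trans (n≤1+n 2) (proj₁ (ValidIdx-∷⁻ a I valid))))
  reps-complete 1 (a ∷ I) valid a<3 = ⊥-elim (<⇒≱ a<3 (proj₁ (ValidIdx-∷⁻ a I valid)))
  reps-complete (suc (suc n)) [] _ _ = ∈-++⁺ˡ (reps-complete (suc n) [] tt (s≤s z≤n))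
  reps-complete (suc (suc n)) (a ∷ I) valid (s≤s a≤3+n) with m≤n⇒m<n∨m≡n a≤3+n
  ... | inj₁ a<3+n = ∈-++⁺ˡ (reps-complete (suc n) (a ∷ I) valid a<3+n)
  ... | inj₂ refl  = ∈-++⁺ʳ (reps (suc n)) (∈-map⁺ ((3 + n) ∷_) (tail-∈-reps n I valid))

  tail-∈-reps : ∀ m r → ValidIdx ((3 + m) ∷ r) → r ∈ reps m
  tail-∈-reps m r valid with ValidIdx-∷⁻ (3 + m) r valid
  ... | _ , r-valid , 2+r≤3+m = reps-complete m r r-valid (≤-pred 2+r≤3+m)

reps-length : ∀ n → length (reps n) ≡ F (suc n)
reps-length 0 = refl
reps-length 1 = refl
reps-length (suc (suc n)) = begin
  length (reps (suc n) ++ map ((3 + n) ∷_) (reps n))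
    ≡⟨ length-++ (reps (suc n)) ⟩
  length (reps (suc n)) + length (map ((3 + n) ∷_) (reps n))
    ≡⟨ cong (length (reps (suc n)) +_) (length-map ((3 + n) ∷_) (reps n)) ⟩
  length (reps (suc n)) + length (reps n)
    ≡⟨ cong₂ _+_ (reps-length (suc n)) (reps-length n) ⟩
  F (3 + n) ∎

reps-increasing : ∀ n → AllPairs (_<_ on value) (reps n)
reps-increasing 0 = [] ∷ []
reps-increasing 1 = [] ∷ []
reps-increasing (suc (suc n)) = AllPairsₚ.++⁺ (reps-increasing (suc n))
  (AllPairsₚ.map⁺ (AllPairs.map (λ {I} {J} → value-∷-mono (3 + n) {I} {J}) (reps-increasing n)))
  (All.tabulate λ I∈ → All.tabulate λ J∈ → old<new I∈ J∈)
  where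
  old<new : ∀ {I J} → I ∈ reps (suc n) → J ∈ map ((3 + n) ∷_) (reps n) → value I < value J
  old<new {I} I∈ J∈ with reps-sound (suc n) I∈ | ∈-map⁻ ((3 + n) ∷_) J∈
  ... | valid , I<3+n | r , _ , refl = <-≤-trans (largestIndex<⇒value< I valid I<3+n)
                                                 (+-monoʳ-≤ (L 0) (m≤m+n (L (3 + n)) (sum (map L r))))

values-enum : ∀ n y → y ∈ map value (reps n) ⇔ (X₀ y × y < L 0 + L (2 + n))
values-enum n y = mk⇔ to from
  where
  to : y ∈ map value (reps n) → X₀ y × y < L 0 + L (2 + n)
  to y∈ with ∈-map⁻ value y∈
  ... | I , I∈ , refl with reps-sound n I∈
  ... | valid , I<2+n = (I , valid , refl) , largestIndex<⇒value< I valid I<2+n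
  from : X₀ y × y < L 0 + L (2 + n) → y ∈ map value (reps n)
  from ((I , valid , refl) , y<) = ∈-map⁺ value (reps-complete n I valid (value<⇒largestIndex< I y<))

map-split : ∀ {A B : Set} (f : A → B) {xs P S x} → xs ≡ P ++ x ∷ S →
            map f xs ≡ map f P ++ f x ∷ map f S
map-split f {P = P} {S} {x} refl = map-++ f P (x ∷ S)

reps-split : ∀ m {P r S} → reps m ≡ P ++ r ∷ S →
             reps (2 + m) ≡ (reps (1 + m) ++ map ((3 + m) ∷_) P) ++ ((3 + m) ∷ r) ∷ map ((3 + m) ∷_) S
reps-split m {P} {r} {S} split = begin
  reps (1 + m) ++ map ((3 + m) ∷_) (reps m)
    ≡⟨ cong (reps (1 + m) ++_) (map-split ((3 + m) ∷_) split) ⟩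
  reps (1 + m) ++ (map ((3 + m) ∷_) P ++ ((3 + m) ∷ r) ∷ map ((3 + m) ∷_) S)
    ≡⟨ ++-assoc (reps (1 + m)) (map ((3 + m) ∷_) P) _ ⟨
  (reps (1 + m) ++ map ((3 + m) ∷_) P) ++ ((3 + m) ∷ r) ∷ map ((3 + m) ∷_) S ∎

isNth-top⇔ : ∀ m {P r S} → reps m ≡ P ++ r ∷ S →
             ∀ i → IsNth i (value ((3 + m) ∷ r)) ⇔ (i ≡ suc (F (2 + m) + length P))
isNth-top⇔ m {P} split i = subst (λ k → IsNth i _ ⇔ (i ≡ suc k)) prefix-length
  (isNth⇔prefix-length (AllPairsₚ.map⁺ (reps-increasing (2 + m))) (values-enum (2 + m))
                       (map-split value (reps-split m split)) i)
  where
  prefix-length : length (map value (reps (1 + m) ++ map ((3 + m) ∷_) P)) ≡ F (2 + m) + length P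
  prefix-length = begin
    length (map value (reps (1 + m) ++ map ((3 + m) ∷_) P))
      ≡⟨ length-map value (reps (1 + m) ++ map ((3 + m) ∷_) P) ⟩
    length (reps (1 + m) ++ map ((3 + m) ∷_) P)
      ≡⟨ length-++ (reps (1 + m)) ⟩
    length (reps (1 + m)) + length (map ((3 + m) ∷_) P)
      ≡⟨ cong₂ _+_ (reps-length (1 + m)) (length-map ((3 + m) ∷_) P) ⟩
    F (2 + m) + length P ∎

range⇒offset : ∀ {a b i} → a + 1 ≤ i → i ≤ a + b → ∃ λ q → q < b × i ≡ suc (a + q)
range⇒offset {a} {i = zero} lo _ with m+n≤o⇒n≤o a lo
... | ()
range⇒offset {a} {b} {suc i} lo hi = i ∸ a , q<b , cong suc (sym a+q≡i)
  where
  a+q≡i : a + (i ∸ a) ≡ i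
  a+q≡i = m+[n∸m]≡n (≤-pred (subst (_≤ suc i) (+-comm a 1) lo))
  q<b : i ∸ a < b
  q<b = +-cancelˡ-≤ a _ _ (subst (_≤ a + b) (sym (trans (+-suc a (i ∸ a)) (cong suc a+q≡i))) hi)

offset⇒range : ∀ {a b q} → q < b → a + 1 ≤ suc (a + q) × suc (a + q) ≤ a + b
offset⇒range {a} {b} {q} q<b = subst (_≤ suc (a + q)) (+-comm 1 a) (s≤s (m≤m+n a q)) ,
                                subst (_≤ a + b) (+-suc a q) (+-monoʳ-≤ a q<b)

lemma4p1 : (j : ℕ) → 3 ≤ j → (i : ℕ) →
    ((F (j ∸ 1) + 1 ≤ i) × (i ≤ F j)) ⇔ (Σ ℕ λ x → IsNth i x × LargestSummandIs j x)
lemma4p1 (suc (suc (suc m))) (s≤s (s≤s (s≤s z≤n))) i = mk⇔ range⇒top top⇒range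
  where
  range⇒top : F (2 + m) + 1 ≤ i × i ≤ F (3 + m) → Σ ℕ λ x → IsNth i x × LargestSummandIs (3 + m) x
  range⇒top (lo , hi) with range⇒offset lo hi
  ... | q , q<F , i≡ with split-at (reps m) (subst (q <_) (sym (reps-length m)) q<F)
  ... | P , r , S , split , refl =
    value ((3 + m) ∷ r) , Equivalence.from (isNth-top⇔ m split i) i≡ ,
    (3 + m) ∷ r , ∷-reps-valid m (subst (r ∈_) (sym split) (∈-++⁺ʳ P (here refl))) , refl , refl

  top⇒range : (Σ ℕ λ x → IsNth i x × LargestSummandIs (3 + m) x) → F (2 + m) + 1 ≤ i × i ≤ F (3 + m)
  top⇒range (_ , _ , [] , _ , _ , ())
  top⇒range (_ , nth , a ∷ r , valid , refl , refl) with ∈-∃++ (tail-∈-reps m r valid)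
  ... | P , S , split = subst (λ k → F (2 + m) + 1 ≤ k × k ≤ F (3 + m))
    (sym (Equivalence.to (isNth-top⇔ m split i) nth))
    (offset⇒range (subst (length P <_) (reps-length m) (length-prefix< split)))
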